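{- For every agent $a$ and all formulas $\phi,\psi$ of the language below, the following formulas are valid on polychromatic models (i.e. true at every world of every polychromatic model): 1. $[\unrhd]_a(\phi\to\psi)\to([\unrhd]_a\phi\to[\unrhd]_a\psi)$; 2. $\mathsf{alive}(a)\to([\unrhd]_a\phi\to\phi)$; 3. $[\unrhd]_a\phi\to[\unrhd]_a[\unrhd]_a\phi$; 4. $\langle\unrhd\rangle_a[\unrhd]_a\phi\to[\unrhd]_a\langle\unrhd\rangle_a\phi$.
   Context: Let $\mathsf{Ag}$ be a finite set of agents and $\mathsf{Prop}$ a countable set of atomic propositions. A simplicial complex is a pair $C=(S,\mathcal{V})$ with $S\subseteq\mathcal{P}(\mathcal{V})\setminus\{\emptyset\}$ closed under nonempty subsets; $\mathcal{F}(C)$ is its set of inclusion-maximal elements. A polychromatic model is $\mathcal{C}=(C,\chi,W,\ell)$ with $C=(S,\mathcal{V})$ a simplicial complex, $\chi:\mathcal{V}\to\mathsf{Ag}$ an arbitrary coloring, $\mathcal{F}(C)\subseteq W\subseteq S$ the set of worlds, $\ell:W\to\mathcal{P}(\mathsf{Prop})$, satisfying: for all $X,Y,Z\in W$ and $G\subseteq\mathsf{Ag}$, $G\subseteq\chi(X\cap Y)$ and $G\subseteq\chi(Y\cap Z)$ imply $G\subseteq\chi(X\cap Z)$, where $\chi(U)=\{\chi(u)\mid u\in U\}$. Write $X\sim_G Y$ iff $G\subseteq\chi(X\cap Y)$, and $\sim_a$ for $\sim_{\{a\}}$. Let $m_a(X)=|\{v\in X\mid\chi(v)=a\}|$ and $X\unrhd_a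 Y$ iff $X\sim_a Y$ and $m_a(X)\ge m_a(Y)$. Formulas: $\phi::=p\mid\neg\phi\mid\phi\wedge\phi\mid[\sim]_G\phi\mid[\unrhd]_a\phi$ ($p\in\mathsf{Prop}$, $G\subseteq\mathsf{Ag}$, $a\in\mathsf{Ag}$), with other Boolean connectives defined as usual, $\bot:=p\wedge\neg p$ for a fixed $p$, $\langle\unrhd\rangle_a\phi:=\neg[\unrhd]_a\neg\phi$, $\mathsf{alive}(G):=\neg[\sim]_G\bot$, and $\mathsf{alive}(a):=\mathsf{alive}(\{a\})$. Truth at $X\in W$: $\mathcal{C},X\Vdash p$ iff $p\in\ell(X)$; Boolean clauses as usual; $\mathcal{C},X\Vdash[\sim]_G\phi$ iff $\mathcal{C},Y\Vdash\phi$ for all $Y\in W$ with $X\sim_G Y$; $\mathcal{C},X\Vdash[\unrhd]_a\phi$ iff $\mathcal{C},Y\Vdash\phi$ for all $Y\in W$ with $X\unrhd_a Y$. -}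

module Defs where

open import Data.Nat using (ℕ; _≥_)
open import Data.Bool using (Bool; T)
open import Data.Fin using (Fin) renaming (_≟_ to _≟ᶠ_)
open import Data.Fin.Subset using (Subset; ⁅_⁆) renaming (_∈_ to _∈ˢ_)
open import Data.List using (List; []; length; filter)
open import Data.List.Membership.Propositional using (_∈_)
open import Data.List.Relation.Unary.Unique.Propositional using (Unique)
open import Data.Product using (_×_; ∃)
open import Relation.Binary.PropositionalEquality using (_≡_; _≢_)
open import Relation.Nullary using (¬_)

-- A (finite) simplex / world is represented by a
-- duplicate-free list of vertices; two lists denote the same set when they have
-- the same members.

_⊆ˡ_ : {V : Set} → List V → List V → Set
X ⊆ˡ Y = ∀ {v} → v ∈ X → v ∈ Y

_≈ˡ_ : {V : Set} → List V → List V → Set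
X ≈ˡ Y = (X ⊆ˡ Y) × (Y ⊆ˡ X)

record SimplicialComplex (V : Set) : Set₁ where
  field
    S         : List V → Set
    S-unique  : ∀ {X} → S X → Unique X
    S-nonempty : ∀ {X} → S X → X ≢ []
    S-closed  : ∀ {X Y} → S X → Unique Y → Y ≢ [] → Y ⊆ˡ X → S Y

  Facet : List V → Set
  Facet X = S X × (∀ {Y} → S Y → X ⊆ˡ Y → Y ⊆ˡ X)

module _ {k : ℕ} {V : Set} (χ : V → Fin k) where

  _⊆χ[_∩_] : Subset k → List V → List V → Set
  G ⊆χ[ X ∩ Y ] = ∀ {g} → g ∈ˢ G → ∃ λ u → u ∈ X × u ∈ Y × χ u ≡ g

  mult : Fin k → List V → ℕ
  mult a X = length (filter (λ v → χ v ≟ᶠ a) X)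

record PolyModel (k : ℕ) (V : Set) : Set₁ where
  field
    C      : SimplicialComplex V
    χ      : V → Fin k
    W      : List V → Set
  open SimplicialComplex C public
  field
    W⊆S    : ∀ {X} → W X → S X
    F⊆W    : ∀ {X} → Facet X → W X
    W-resp : ∀ {X Y} → W X → Unique Y → X ≈ˡ Y → W Y
    ℓ      : List V → ℕ → Bool
    ℓ-resp : ∀ {X Y} → W X → X ≈ˡ Y → ∀ p → ℓ X p ≡ ℓ Y p
    trans-cond : ∀ {X Y Z} → W X → W Y → W Z → (G : Subset k) →
                 _⊆χ[_∩_] χ G X Y → _⊆χ[_∩_] χ G Y Z → _⊆χ[_∩_] χ G X Z

  _∼[_]_ : List V → Subset k → List V → Set
  X ∼[ G ] Y = _⊆χ[_∩_] χ G X Y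

  m : Fin k → List V → ℕ
  m = mult χ

  _⊵[_]_ : List V → Fin k → List V → Set
  X ⊵[ a ] Y = (X ∼[ ⁅ a ⁆ ] Y) × (m a X ≥ m a Y)

data Form (k : ℕ) : Set where
  atom : ℕ → Form k
  ~_   : Form k → Form k
  _∧_  : Form k → Form k → Form k
  [∼]  : Subset k → Form k → Form k
  [⊵]  : Fin k → Form k → Form k

infix  9 ~_
infixr 7 _∧_
infixr 6 _⇒_

_⇒_ : ∀ {k} → Form k → Form k → Form k
φ ⇒ ψ = ~ (φ ∧ ~ ψ)

⊥f : ∀ {k} → Form k
⊥f = atom 0 ∧ ~ atom 0

⟨⊵⟩ : ∀ {k} → Fin k → Form k → Form k
⟨⊵⟩ a φ = ~ [⊵] a (~ φ)

alive : ∀ {k} → Subset k → Form k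
alive G = ~ [∼] G ⊥f

aliveₐ : ∀ {k} → Fin k → Form k
aliveₐ a = alive ⁅ a ⁆

module _ {k : ℕ} {V : Set} (M : PolyModel k V) where
  open PolyModel M

  _⊩_ : List V → Form k → Set
  X ⊩ atom p  = T (ℓ X p)
  X ⊩ (~ φ)   = ¬ (X ⊩ φ)
  X ⊩ (φ ∧ ψ) = (X ⊩ φ) × (X ⊩ ψ)
  X ⊩ [∼] G φ = ∀ Y → W Y → X ∼[ G ] Y → Y ⊩ φ
  X ⊩ [⊵] a φ = ∀ Y → W Y → X ⊵[ a ] Y → Y ⊩ φ

Valid : ∀ {k} → Form k → Set₁
Valid {k} φ = ∀ {V : Set} (M : PolyModel k V) X → PolyModel.W M X → _⊩_ M X φ

{-# OPTIONS --safe #-}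
module Submission where

-- The truth relation is stable under double negation, so the negation-encoded
-- connectives behave classically and the four formulas reduce to frame
-- properties of ⊵ₐ: it is reflexive at every world where a is alive,
-- transitive because ∼ₐ is transitive on worlds, and confluent because
-- multiplicities are totally ordered — of two ⊵ₐ-successors of a world, the
-- one of smaller a-multiplicity is a ⊵ₐ-successor of both.

open import Defs
open import Data.Nat using (ℕ)
open import Data.Nat.Properties using (≤-refl; ≤-trans; ≤-total)
open import Data.Fin using (Fin)
open import Data.Fin.Subset using (⁅_⁆)
open import Data.Fin.Subset.Properties using (x∈⁅x⁆; x∈⁅y⁆⇒x≡y)
open import Data.List using (List)
open import Data.Product using (_×_; _,_; proj₁; proj₂; ∃)
open import Data.Sum using (inj₁; inj₂)
open import Relation.Binary.PropositionalEquality using (trans; sym)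
open import Relation.Nullary using (¬_)
open import Relation.Nullary.Decidable using (T?; decidable-stable)
open import Relation.Nullary.Negation using (Stable; negated-stable; ¬¬-map; contradiction)

module _ {k : ℕ} {V : Set} (χ : V → Fin k) where

  ⊆χ-sym : ∀ {G X Y} → _⊆χ[_∩_] χ G X Y → _⊆χ[_∩_] χ G Y X
  ⊆χ-sym X∼Y g∈G with X∼Y g∈G
  ... | u , u∈X , u∈Y , χu≡g = u , u∈Y , u∈X , χu≡g

  ⊆χ⁅⁆-reflˡ : ∀ {a X Y} → _⊆χ[_∩_] χ ⁅ a ⁆ X Y → _⊆χ[_∩_] χ ⁅ a ⁆ X X
  ⊆χ⁅⁆-reflˡ {a} X∼Y g∈⁅a⁆ with X∼Y (x∈⁅x⁆ a)
  ... | u , u∈X , _ , χu≡a = u , u∈X , u∈X , trans χu≡a (sym (x∈⁅y⁆⇒x≡y a g∈⁅a⁆))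

module _ {k : ℕ} {V : Set} (M : PolyModel k V) where
  open PolyModel M

  infix 4 _⊨_
  _⊨_ : List V → Form k → Set
  _⊨_ = _⊩_ M

  ⊩-stable : ∀ φ {X} → Stable (X ⊨ φ)
  ⊩-stable (atom p) {X} = decidable-stable (T? (ℓ X p))
  ⊩-stable (~ φ) = negated-stable
  ⊩-stable (φ ∧ ψ) ¬¬φ∧ψ = ⊩-stable φ (¬¬-map proj₁ ¬¬φ∧ψ) , ⊩-stable ψ (¬¬-map proj₂ ¬¬φ∧ψ)
  ⊩-stable ([∼] G φ) ¬¬□φ Y wY X∼Y = ⊩-stable φ (¬¬-map (λ □φ → □φ Y wY X∼Y) ¬¬□φ)
  ⊩-stable ([⊵] a φ) ¬¬□φ Y wY X⊵Y = ⊩-stable φ (¬¬-map (λ □φ → □φ Y wY X⊵Y) ¬¬□φ)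

  -- The formulas are explicit since Agda cannot recover them from a reduced X ⊨ φ.
  ⇒-intro : ∀ {X} φ ψ → (X ⊨ φ → X ⊨ ψ) → X ⊨ φ ⇒ ψ
  ⇒-intro _ _ φ→ψ (x⊨φ , x⊭ψ) = x⊭ψ (φ→ψ x⊨φ)

  ⇒-elim : ∀ {X} φ ψ → X ⊨ φ ⇒ ψ → X ⊨ φ → X ⊨ ψ
  ⇒-elim _ ψ x⊨φ⇒ψ x⊨φ = ⊩-stable ψ (λ x⊭ψ → x⊨φ⇒ψ (x⊨φ , x⊭ψ))

  ∼-euclidean : ∀ {G X Y Z} → W X → W Y → W Z → X ∼[ G ] Y → X ∼[ G ] Z → Y ∼[ G ] Z
  ∼-euclidean {G} wX wY wZ X∼Y = trans-cond wY wX wZ G (⊆χ-sym χ X∼Y)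

  ⊵-reflˡ : ∀ {a X Y} → X ∼[ ⁅ a ⁆ ] Y → X ⊵[ a ] X
  ⊵-reflˡ X∼Y = ⊆χ⁅⁆-reflˡ χ X∼Y , ≤-refl

  ⊵-trans : ∀ {a X Y Z} → W X → W Y → W Z → X ⊵[ a ] Y → Y ⊵[ a ] Z → X ⊵[ a ] Z
  ⊵-trans {a} wX wY wZ (X∼Y , mY≤mX) (Y∼Z , mZ≤mY) =
    trans-cond wX wY wZ ⁅ a ⁆ X∼Y Y∼Z , ≤-trans mZ≤mY mY≤mX

  ⊵-confluent : ∀ {a X Y Z} → W X → W Y → W Z → X ⊵[ a ] Y → X ⊵[ a ] Z →
                ∃ λ U → W U × Y ⊵[ a ] U × Z ⊵[ a ] U
  ⊵-confluent {a} {Y = Y} {Z} wX wY wZ (X∼Y , _) (X∼Z , _) with ≤-total (m a Y) (m a Z)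
  ... | inj₁ mY≤mZ = Y , wY , ⊵-reflˡ (⊆χ-sym χ X∼Y) , (∼-euclidean wX wZ wY X∼Z X∼Y , mY≤mZ)
  ... | inj₂ mZ≤mY = Z , wZ , (∼-euclidean wX wY wZ X∼Y X∼Z , mZ≤mY) , ⊵-reflˡ (⊆χ-sym χ X∼Z)

  alive⇒¬¬⊵-refl : ∀ {a X} → X ⊨ aliveₐ a → ¬ ¬ (X ⊵[ a ] X)
  alive⇒¬¬⊵-refl x⊨alive X⋬X = x⊨alive (λ _ _ X∼Y → contradiction (⊵-reflˡ X∼Y) X⋬X)

module _ {k : ℕ} (a : Fin k) where

  K-valid : ∀ φ ψ → Valid ([⊵] a (φ ⇒ ψ) ⇒ ([⊵] a φ ⇒ [⊵] a ψ))
  K-valid φ ψ M X _ =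
    ⇒-intro M ([⊵] a (φ ⇒ ψ)) ([⊵] a φ ⇒ [⊵] a ψ) λ □φ⇒ψ →
    ⇒-intro M ([⊵] a φ) ([⊵] a ψ) λ □φ Y wY X⊵Y →
    ⇒-elim M φ ψ (□φ⇒ψ Y wY X⊵Y) (□φ Y wY X⊵Y)

  T-valid : ∀ φ → Valid (aliveₐ a ⇒ ([⊵] a φ ⇒ φ))
  T-valid φ M X wX =
    ⇒-intro M (aliveₐ a) ([⊵] a φ ⇒ φ) λ x⊨alive →
    ⇒-intro M ([⊵] a φ) φ λ □φ →
    ⊩-stable M φ λ x⊭φ → alive⇒¬¬⊵-refl M x⊨alive λ X⊵X → x⊭φ (□φ X wX X⊵X)

  4-valid : ∀ φ → Valid ([⊵] a φ ⇒ [⊵] a ([⊵] a φ))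
  4-valid φ M X wX =
    ⇒-intro M ([⊵] a φ) ([⊵] a ([⊵] a φ)) λ □φ Y wY X⊵Y Z wZ Y⊵Z →
    □φ Z wZ (⊵-trans M wX wY wZ X⊵Y Y⊵Z)

  Geach-valid : ∀ φ → Valid (⟨⊵⟩ a ([⊵] a φ) ⇒ [⊵] a (⟨⊵⟩ a φ))
  Geach-valid φ M X wX =
    ⇒-intro M (⟨⊵⟩ a ([⊵] a φ)) ([⊵] a (⟨⊵⟩ a φ)) λ ◇□φ Y wY X⊵Y □¬φ →
    ◇□φ λ Z wZ X⊵Z □φ →
    let U , wU , Y⊵U , Z⊵U = ⊵-confluent M wX wY wZ X⊵Y X⊵Z
    in □¬φ U wU Y⊵U (□φ U wU Z⊵U)

mainTheorem2 : ∀ {k : ℕ} (a : Fin k) (φ ψ : Form k) →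
    Valid ([⊵] a (φ ⇒ ψ) ⇒ ([⊵] a φ ⇒ [⊵] a ψ))
    × Valid (aliveₐ a ⇒ ([⊵] a φ ⇒ φ))
    × Valid ([⊵] a φ ⇒ [⊵] a ([⊵] a φ))
    × Valid (⟨⊵⟩ a ([⊵] a φ) ⇒ [⊵] a (⟨⊵⟩ a φ))
mainTheorem2 a φ ψ = K-valid a φ ψ , T-valid a φ , 4-valid a φ , Geach-valid a φ
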